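{- Let $\Gamma;s$ be an extended context and $\lambda x\leq t.u$ a term. Then $\Gamma;s\vdash\top\leq^*_{\mathrm{wf}}\lambda x\leq t.u$ does not hold.
   Context: Terms: $t ::= x \mid \top \mid (\lambda x\leq t.u) \mid (u\,v)$, with $x$ from a countably infinite set of variables and $\top$ a constant; $x$ is bound in $u$ in $\lambda x\leq t.u$; terms identified up to renaming of bound variables; $\mathrm{fv}$ = free variables, $u[x:=v]$ = capture-avoiding substitution. Extended context $\Gamma;s$: a finite sequence $\Gamma$ of annotations $x\leq t$ and a finite list (stack) $s$ of terms; $\varepsilon;[]$ empty, $\Gamma,x\leq t;s$ appends an annotation, $\Gamma;\alpha::s$ pushes $\alpha$. $\mathrm{dom}(\Gamma)$ = annotated variables; $x\leq t\in\Gamma$ means the annotation occurs in $\Gamma$; "$x$ has subtype $t$ in $\Gamma$" means $x\leq t$ is the last annotation for $x$ in $\Gamma$. Prevalidity: least predicate with $\varepsilon;[]$ prevalid; $\Gamma,x\leq t;[]$ prevalid if $\Gamma;[]$ prevalid, $x\notin\mathrm{dom}(\Gamma)$, $\mathrm{fv}(t)\subseteq\mathrm{dom}(\Gamma)$; $\Gamma;\alpha::s$ prevalid if $\Gamma;s$ prevalid and $\mathrm{fv}(\alpha)\subseteq\mathrm{dom}(\Gamma)$. Equivalence reduction $\to_{\equiv}$: least relation with $x\to_{\equiv}x$; $\top\to_{\equiv}\top$; $\top\,u\to_{\equiv}\top$; if $u\to_{\equiv}u'$, $v\to_{\equiv}v'$ then $u\,v\to_{\equiv}u'\,v'$ and $(\lambda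 x\leq t.u)\,v\to_{\equiv}u'[x:=v']$; if $t\to_{\equiv}t'$, $u\to_{\equiv}u'$ then $\lambda x\leq t.u\to_{\equiv}\lambda x\leq t'.u'$. Subtyping reduction $\Gamma;s\vdash u\to_{\leq}v$: least relation with (Prom) $\Gamma;s$ prevalid and $x\leq t\in\Gamma$ give $\Gamma;s\vdash x\to_{\leq}t$; (Top) $\Gamma;s$ prevalid gives $\Gamma;s\vdash u\to_{\leq}\top$; (Eq) $\Gamma;s$ prevalid and $u\to_{\equiv}v$ give $\Gamma;s\vdash u\to_{\leq}v$; (App) $\Gamma;v::s\vdash u\to_{\leq}u'$ gives $\Gamma;s\vdash u\,v\to_{\leq}u'\,v$; (FunOp) $\Gamma,x\leq\alpha;s\vdash u\to_{\leq}u'$ gives $\Gamma;\alpha::s\vdash\lambda x\leq t.u\to_{\leq}\lambda x\leq t.u'$; (Fun) $\Gamma,x\leq t;[]\vdash u\to_{\leq}u'$ gives $\Gamma;[]\vdash\lambda x\leq t.u\to_{\leq}\lambda x\leq t.u'$. Subtyping: $\Gamma;s\vdash v\leq t$ is the least relation with: if $\Gamma;s$ prevalid then $\Gamma;s\vdash t\leq t$; if $\Gamma;s\vdash v\to_{\leq}v'$ and $\Gamma;s\vdash v'\leq t$ then $\Gamma;s\vdash v\leq t$; if $\Gamma;s\vdash v\leq t'$ and $t\to_{\equiv}t'$ then $\Gamma;s\vdash v\leq t$. Well-formedness $\Gamma;s\vdash t\ \mathrm{wf}$, well-subtyping $\leq_{\mathrm{wf}}$ and transitive well-subtyping $\leq^*_{\mathrm{wf}}$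 are the least relations (defined simultaneously) with: (W-Var) if $\Gamma;s$ prevalid, $x$ has subtype $t$ in $\Gamma$ and $\Gamma;s\vdash t\ \mathrm{wf}$ then $\Gamma;s\vdash x\ \mathrm{wf}$; (W-Top) if $\Gamma;s$ prevalid then $\Gamma;s\vdash\top\ \mathrm{wf}$; (W-Fun) if $\Gamma,x\leq t;[]\vdash u\ \mathrm{wf}$ and $\Gamma;[]\vdash t\ \mathrm{wf}$ then $\Gamma;[]\vdash\lambda x\leq t.u\ \mathrm{wf}$; (W-FunOp) if $\Gamma,x\leq\delta;s\vdash u\ \mathrm{wf}$ and $\Gamma;[]\vdash t\ \mathrm{wf}$ then $\Gamma;\delta::s\vdash\lambda x\leq t.u\ \mathrm{wf}$; (W-App) if $\Gamma;v::s\vdash u\leq^*_{\mathrm{wf}}\lambda x\leq t.\top$ and $\Gamma;[]\vdash v\leq^*_{\mathrm{wf}}t$ then $\Gamma;s\vdash u\,v\ \mathrm{wf}$; (Wf-Rule) if $\Gamma;s\vdash u\ \mathrm{wf}$, $\Gamma;s\vdash t\ \mathrm{wf}$ and $\Gamma;s\vdash u\leq t$ then $\Gamma;s\vdash u\leq_{\mathrm{wf}}t$; (Wf-Sub) $\Gamma;s\vdash v\leq_{\mathrm{wf}}t$ gives $\Gamma;s\vdash v\leq^*_{\mathrm{wf}}t$; (Wf-Trans) if $\Gamma;s\vdash v\leq^*_{\mathrm{wf}}u$, $\Gamma;s\vdash u\leq^*_{\mathrm{wf}}t$ and $\Gamma;s\vdash u\ \mathrm{wf}$ then $\Gamma;s\vdash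 v\leq^*_{\mathrm{wf}}t$. -}

module Defs where

open import Data.Nat using (ℕ; zero; suc)
open import Data.Fin using (Fin; zero; suc)
open import Data.List using (List; []; _∷_; _++_)
open import Data.List.Membership.Propositional using (_∈_; _∉_)
open import Data.List.Relation.Unary.All using (All)
open import Data.Product using (Σ; _×_; _,_)
open import Relation.Binary.PropositionalEquality using (_≡_; _≢_)

-- Terms, up to alpha-equivalence, in locally nameless / well-scoped form.
-- Term n : terms with at most n dangling bound variables (de Bruijn
-- indices, Fin n); free variables are names (ℕ).  Closed-under-binders
-- terms of the paper (identified up to renaming of bound variables)
-- are exactly the elements of  Term 0.
-- lam t u  represents  λ x ≤ t . u  (u has the bound variable as index 0).

data Term : ℕ → Set where
  bvar : ∀ {n} → Fin n → Term n
  fvar : ∀ {n} → ℕ → Term n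
  top  : ∀ {n} → Term n
  lam  : ∀ {n} → Term n → Term (suc n) → Term n
  app  : ∀ {n} → Term n → Term n → Term n

Tm : Set
Tm = Term 0

ext : ∀ {m n} → (Fin m → Fin n) → Fin (suc m) → Fin (suc n)
ext ρ zero    = zero
ext ρ (suc i) = suc (ρ i)

rename : ∀ {m n} → (Fin m → Fin n) → Term m → Term n
rename ρ (bvar i)  = bvar (ρ i)
rename ρ (fvar x)  = fvar x
rename ρ top       = top
rename ρ (lam t u) = lam (rename ρ t) (rename (ext ρ) u)
rename ρ (app u v) = app (rename ρ u) (rename ρ v)

exts : ∀ {m n} → (Fin m → Term n) → Fin (suc m) → Term (suc n)
exts σ zero    = bvar zero
exts σ (suc i) = rename suc (σ i)

bsubst : ∀ {m n} → (Fin m → Term n) → Term m → Term n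
bsubst σ (bvar i)  = σ i
bsubst σ (fvar x)  = fvar x
bsubst σ top       = top
bsubst σ (lam t u) = lam (bsubst σ t) (bsubst (exts σ) u)
bsubst σ (app u v) = app (bsubst σ u) (bsubst σ v)

-- instantiate the outermost bound variable of a body by v:
-- for  λ x ≤ t . u  this computes  u[x := v]
inst1 : ∀ {n} → Term n → Fin (suc n) → Term n
inst1 v zero    = v
inst1 v (suc i) = bvar i

inst : ∀ {n} → Term (suc n) → Term n → Term n
inst u v = bsubst (inst1 v) u

open₁ : Term 1 → ℕ → Tm
open₁ u x = inst u (fvar x)

fv : ∀ {n} → Term n → List ℕ
fv (bvar i)  = []
fv (fvar x)  = x ∷ []
fv top       = []
fv (lam t u) = fv t ++ fv u
fv (app u v) = fv u ++ fv v

infixl 5 _,_≤_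

data Ctx : Set where
  ε     : Ctx
  _,_≤_ : Ctx → ℕ → Tm → Ctx

Stack : Set
Stack = List Tm

data _∈dom_ : ℕ → Ctx → Set where
  here  : ∀ {Γ x t} → x ∈dom (Γ , x ≤ t)
  there : ∀ {Γ x y t} → x ∈dom Γ → x ∈dom (Γ , y ≤ t)

_∉dom_ : ℕ → Ctx → Set
x ∉dom Γ = x ∈dom Γ → Data.Empty.⊥
  where import Data.Empty

data Ann : ℕ → Tm → Ctx → Set where
  here  : ∀ {Γ x t} → Ann x t (Γ , x ≤ t)
  there : ∀ {Γ x t y t'} → Ann x t Γ → Ann x t (Γ , y ≤ t')

data HasSub : Ctx → ℕ → Tm → Set where
  here  : ∀ {Γ x t} → HasSub (Γ , x ≤ t) x t
  there : ∀ {Γ x t y t'} → x ≢ y → HasSub Γ x t → HasSub (Γ , y ≤ t') x t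

_⊆dom_ : List ℕ → Ctx → Set
xs ⊆dom Γ = All (λ y → y ∈dom Γ) xs

data Prevalid : Ctx → Stack → Set where
  pv-empty : Prevalid ε []
  pv-ann   : ∀ {Γ x t} → Prevalid Γ [] → x ∉dom Γ → fv t ⊆dom Γ →
             Prevalid (Γ , x ≤ t) []
  pv-push  : ∀ {Γ α s} → Prevalid Γ s → fv α ⊆dom Γ → Prevalid Γ (α ∷ s)

infix 4 _→≡_

data _→≡_ : ∀ {n} → Term n → Term n → Set where
  ≡-bvar : ∀ {n} {i : Fin n} → bvar i →≡ bvar i
  ≡-var  : ∀ {n x} → fvar {n} x →≡ fvar x
  ≡-top  : ∀ {n} → top {n} →≡ top
  ≡-topapp : ∀ {n} {u : Term n} → app top u →≡ top
  ≡-app  : ∀ {n} {u u' v v' : Term n} → u →≡ u' → v →≡ v' →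
           app u v →≡ app u' v'
  ≡-beta : ∀ {n} {t : Term n} {u u' : Term (suc n)} {v v' : Term n} →
           u →≡ u' → v →≡ v' → app (lam t u) v →≡ inst u' v'
  ≡-lam  : ∀ {n} {t t' : Term n} {u u' : Term (suc n)} → t →≡ t' → u →≡ u' →
           lam t u →≡ lam t' u'

-- Subtyping reduction  Γ;s ⊢ u →≤ v
-- Binder rules: the bound variable is represented by some name x not
-- free in the bodies (choice of a representative up to alpha).

data _⨾_⊢_→≤_ : Ctx → Stack → Tm → Tm → Set where
  r-prom  : ∀ {Γ s x t} → Prevalid Γ s → Ann x t Γ → Γ ⨾ s ⊢ fvar x →≤ t
  r-top   : ∀ {Γ s u} → Prevalid Γ s → Γ ⨾ s ⊢ u →≤ top
  r-eq    : ∀ {Γ s u v} → Prevalid Γ s → u →≡ v → Γ ⨾ s ⊢ u →≤ v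
  r-app   : ∀ {Γ s u u' v} → Γ ⨾ (v ∷ s) ⊢ u →≤ u' → Γ ⨾ s ⊢ app u v →≤ app u' v
  r-funop : ∀ {Γ s α t} {u u' : Term 1} (x : ℕ) → x ∉ fv u → x ∉ fv u' →
            (Γ , x ≤ α) ⨾ s ⊢ open₁ u x →≤ open₁ u' x →
            Γ ⨾ (α ∷ s) ⊢ lam t u →≤ lam t u'
  r-fun   : ∀ {Γ t} {u u' : Term 1} (x : ℕ) → x ∉ fv u → x ∉ fv u' →
            (Γ , x ≤ t) ⨾ [] ⊢ open₁ u x →≤ open₁ u' x →
            Γ ⨾ [] ⊢ lam t u →≤ lam t u'

data _⨾_⊢_≤_ : Ctx → Stack → Tm → Tm → Set where
  s-refl : ∀ {Γ s t} → Prevalid Γ s → Γ ⨾ s ⊢ t ≤ t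
  s-step : ∀ {Γ s v v' t} → Γ ⨾ s ⊢ v →≤ v' → Γ ⨾ s ⊢ v' ≤ t → Γ ⨾ s ⊢ v ≤ t
  s-eq   : ∀ {Γ s v t t'} → Γ ⨾ s ⊢ v ≤ t' → t →≡ t' → Γ ⨾ s ⊢ v ≤ t

data _⨾_⊢_wf : Ctx → Stack → Tm → Set
data _⨾_⊢_≤wf_ : Ctx → Stack → Tm → Tm → Set
data _⨾_⊢_≤*wf_ : Ctx → Stack → Tm → Tm → Set

data _⨾_⊢_wf where
  w-var   : ∀ {Γ s x t} → Prevalid Γ s → HasSub Γ x t → Γ ⨾ s ⊢ t wf →
            Γ ⨾ s ⊢ fvar x wf
  w-top   : ∀ {Γ s} → Prevalid Γ s → Γ ⨾ s ⊢ top wf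
  w-fun   : ∀ {Γ t} {u : Term 1} (x : ℕ) → x ∉ fv u →
            (Γ , x ≤ t) ⨾ [] ⊢ open₁ u x wf → Γ ⨾ [] ⊢ t wf →
            Γ ⨾ [] ⊢ lam t u wf
  w-funop : ∀ {Γ s δ t} {u : Term 1} (x : ℕ) → x ∉ fv u →
            (Γ , x ≤ δ) ⨾ s ⊢ open₁ u x wf → Γ ⨾ [] ⊢ t wf →
            Γ ⨾ (δ ∷ s) ⊢ lam t u wf
  w-app   : ∀ {Γ s u v t} → Γ ⨾ (v ∷ s) ⊢ u ≤*wf lam t top →
            Γ ⨾ [] ⊢ v ≤*wf t → Γ ⨾ s ⊢ app u v wf

data _⨾_⊢_≤wf_ where
  wf-rule : ∀ {Γ s u t} → Γ ⨾ s ⊢ u wf → Γ ⨾ s ⊢ t wf → Γ ⨾ s ⊢ u ≤ t →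
            Γ ⨾ s ⊢ u ≤wf t

data _⨾_⊢_≤*wf_ where
  wf-sub   : ∀ {Γ s v t} → Γ ⨾ s ⊢ v ≤wf t → Γ ⨾ s ⊢ v ≤*wf t
  wf-trans : ∀ {Γ s v u t} → Γ ⨾ s ⊢ v ≤*wf u → Γ ⨾ s ⊢ u ≤*wf t →
             Γ ⨾ s ⊢ u wf → Γ ⨾ s ⊢ v ≤*wf t

-- The invariant is "reduces to ⊤ by equivalence reduction".  ⊤ has it and an
-- abstraction never does, since →≡ maps abstractions to abstractions.  It is
-- preserved along ≤*wf, i.e. along every subtyping reduction step of a scoped
-- term.  Under a stack, the step is read on the applied term u a₁ … aₙ (the
-- arguments aᵢ pushed by App): (Top) gives ⊤ a₁ … aₙ, which reduces to ⊤;
-- (Eq) is handled by confluence of →≡; and (FunOp) on λx≤t.u applied to α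
-- corresponds to the β-step to u[x:=α], provided the variable x of the
-- extended context is read as α.  Hence the invariant is stated modulo a
-- substitution σ of free names which sends each such x to (the image of) its
-- annotation; on the other names σ is the identity, and there (Prom) cannot
-- occur because a term headed by a free name never reduces to ⊤.
module Submission where

open import Defs
open import Relation.Nullary using (¬_; yes; no)
open import Data.Nat using (ℕ; suc; _≟_)
open import Data.Fin using (Fin; zero; suc)
open import Data.List using (List; []; _∷_; _++_; map)
open import Data.List.Relation.Unary.All as All using (All; []; _∷_)
open import Data.List.Relation.Unary.All.Properties using (++⁺; ++⁻ˡ; ++⁻ʳ)
open import Data.List.Relation.Unary.Any using (here; there)
open import Data.List.Membership.Propositional using (_∉_)
open import Data.List.Membership.Propositional.Properties using (∈-++⁺ˡ; ∈-++⁺ʳ)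
open import Data.Product using (Σ; _×_; _,_)
open import Data.Empty using (⊥-elim)
open import Function using (_∘_)
open import Relation.Binary.PropositionalEquality
open import Relation.Binary.Construct.Closure.ReflexiveTransitive using (Star; ε; _◅_)

-- Renaming and substitution of bound variables

ext-cong : ∀ {m n} {ρ ρ' : Fin m → Fin n} → (∀ i → ρ i ≡ ρ' i) → ∀ i → ext ρ i ≡ ext ρ' i
ext-cong h zero    = refl
ext-cong h (suc i) = cong suc (h i)

rename-cong : ∀ {m n} {ρ ρ' : Fin m → Fin n} → (∀ i → ρ i ≡ ρ' i) →
              ∀ t → rename ρ t ≡ rename ρ' t
rename-cong h (bvar i)  = cong bvar (h i)
rename-cong h (fvar x)  = refl
rename-cong h top       = refl
rename-cong h (lam t u) = cong₂ lam (rename-cong h t) (rename-cong (ext-cong h) u)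
rename-cong h (app u v) = cong₂ app (rename-cong h u) (rename-cong h v)

exts-cong : ∀ {m n} {σ τ : Fin m → Term n} → (∀ i → σ i ≡ τ i) → ∀ i → exts σ i ≡ exts τ i
exts-cong h zero    = refl
exts-cong h (suc i) = cong (rename suc) (h i)

bsubst-cong : ∀ {m n} {σ τ : Fin m → Term n} → (∀ i → σ i ≡ τ i) →
              ∀ t → bsubst σ t ≡ bsubst τ t
bsubst-cong h (bvar i)  = h i
bsubst-cong h (fvar x)  = refl
bsubst-cong h top       = refl
bsubst-cong h (lam t u) = cong₂ lam (bsubst-cong h t) (bsubst-cong (exts-cong h) u)
bsubst-cong h (app u v) = cong₂ app (bsubst-cong h u) (bsubst-cong h v)

bsubst-id : ∀ {n} (t : Term n) → bsubst bvar t ≡ t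
bsubst-id (bvar i)  = refl
bsubst-id (fvar x)  = refl
bsubst-id top       = refl
bsubst-id (lam t u) = cong₂ lam (bsubst-id t)
  (trans (bsubst-cong (λ { zero → refl ; (suc i) → refl }) u) (bsubst-id u))
bsubst-id (app u v) = cong₂ app (bsubst-id u) (bsubst-id v)

rename-rename : ∀ {l m n} (ρ₁ : Fin l → Fin m) (ρ₂ : Fin m → Fin n) t →
                rename ρ₂ (rename ρ₁ t) ≡ rename (ρ₂ ∘ ρ₁) t
rename-rename ρ₁ ρ₂ (bvar i)  = refl
rename-rename ρ₁ ρ₂ (fvar x)  = refl
rename-rename ρ₁ ρ₂ top       = refl
rename-rename ρ₁ ρ₂ (lam t u) = cong₂ lam (rename-rename ρ₁ ρ₂ t)
  (trans (rename-rename (ext ρ₁) (ext ρ₂) u) (rename-cong (λ { zero → refl ; (suc i) → refl }) u))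
rename-rename ρ₁ ρ₂ (app u v) = cong₂ app (rename-rename ρ₁ ρ₂ u) (rename-rename ρ₁ ρ₂ v)

bsubst-rename : ∀ {l m n} (ρ : Fin l → Fin m) (σ : Fin m → Term n) t →
                bsubst σ (rename ρ t) ≡ bsubst (σ ∘ ρ) t
bsubst-rename ρ σ (bvar i)  = refl
bsubst-rename ρ σ (fvar x)  = refl
bsubst-rename ρ σ top       = refl
bsubst-rename ρ σ (lam t u) = cong₂ lam (bsubst-rename ρ σ t)
  (trans (bsubst-rename (ext ρ) (exts σ) u) (bsubst-cong (λ { zero → refl ; (suc i) → refl }) u))
bsubst-rename ρ σ (app u v) = cong₂ app (bsubst-rename ρ σ u) (bsubst-rename ρ σ v)

rename-bsubst : ∀ {l m n} (σ : Fin l → Term m) (ρ : Fin m → Fin n) t →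
                rename ρ (bsubst σ t) ≡ bsubst (rename ρ ∘ σ) t
rename-bsubst σ ρ (bvar i)  = refl
rename-bsubst σ ρ (fvar x)  = refl
rename-bsubst σ ρ top       = refl
rename-bsubst σ ρ (lam t u) = cong₂ lam (rename-bsubst σ ρ t)
  (trans (rename-bsubst (exts σ) (ext ρ) u) (bsubst-cong rename-exts u))
  where
  rename-exts : ∀ i → rename (ext ρ) (exts σ i) ≡ exts (rename ρ ∘ σ) i
  rename-exts zero    = refl
  rename-exts (suc i) = trans (rename-rename suc (ext ρ) (σ i)) (sym (rename-rename ρ suc (σ i)))
rename-bsubst σ ρ (app u v) = cong₂ app (rename-bsubst σ ρ u) (rename-bsubst σ ρ v)

bsubst-bsubst : ∀ {l m n} (σ₁ : Fin l → Term m) (σ₂ : Fin m → Term n) t →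
                bsubst σ₂ (bsubst σ₁ t) ≡ bsubst (bsubst σ₂ ∘ σ₁) t
bsubst-bsubst σ₁ σ₂ (bvar i)  = refl
bsubst-bsubst σ₁ σ₂ (fvar x)  = refl
bsubst-bsubst σ₁ σ₂ top       = refl
bsubst-bsubst σ₁ σ₂ (lam t u) = cong₂ lam (bsubst-bsubst σ₁ σ₂ t)
  (trans (bsubst-bsubst (exts σ₁) (exts σ₂) u) (bsubst-cong bsubst-exts u))
  where
  bsubst-exts : ∀ i → bsubst (exts σ₂) (exts σ₁ i) ≡ exts (bsubst σ₂ ∘ σ₁) i
  bsubst-exts zero    = refl
  bsubst-exts (suc i) = trans (bsubst-rename suc (exts σ₂) (σ₁ i)) (sym (rename-bsubst σ₂ suc (σ₁ i)))
bsubst-bsubst σ₁ σ₂ (app u v) = cong₂ app (bsubst-bsubst σ₁ σ₂ u) (bsubst-bsubst σ₁ σ₂ v)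

inst-bsubst : ∀ {m n} (σ : Fin m → Term n) (u : Term (suc m)) v →
              bsubst σ (inst u v) ≡ inst (bsubst (exts σ) u) (bsubst σ v)
inst-bsubst σ u v = begin
  bsubst σ (inst u v)                          ≡⟨ bsubst-bsubst (inst1 v) σ u ⟩
  bsubst (bsubst σ ∘ inst1 v) u                ≡⟨ bsubst-cong exts-inst1 u ⟨
  bsubst (bsubst (inst1 (bsubst σ v)) ∘ exts σ) u ≡⟨ bsubst-bsubst (exts σ) (inst1 (bsubst σ v)) u ⟨
  inst (bsubst (exts σ) u) (bsubst σ v)        ∎
  where
  open ≡-Reasoning
  exts-inst1 : ∀ i → bsubst (inst1 (bsubst σ v)) (exts σ i) ≡ bsubst σ (inst1 v i)
  exts-inst1 zero    = refl
  exts-inst1 (suc i) = trans (bsubst-rename suc (inst1 (bsubst σ v)) (σ i)) (bsubst-id (σ i))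

inst-rename : ∀ {m n} (ρ : Fin m → Fin n) (u : Term (suc m)) v →
              rename ρ (inst u v) ≡ inst (rename (ext ρ) u) (rename ρ v)
inst-rename ρ u v = begin
  rename ρ (inst u v)                        ≡⟨ rename-bsubst (inst1 v) ρ u ⟩
  bsubst (rename ρ ∘ inst1 v) u              ≡⟨ bsubst-cong (λ { zero → refl ; (suc i) → refl }) u ⟩
  bsubst (inst1 (rename ρ v) ∘ ext ρ) u      ≡⟨ bsubst-rename (ext ρ) (inst1 (rename ρ v)) u ⟨
  inst (rename (ext ρ) u) (rename ρ v)       ∎
  where open ≡-Reasoning

-- Substitution of closed terms for free names

weaken : ∀ {n} → Tm → Term n
weaken = bsubst (λ ())

weaken-id : (w : Tm) → weaken w ≡ w
weaken-id w = trans (bsubst-cong (λ ()) w) (bsubst-id w)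

rename-weaken : ∀ {m n} (ρ : Fin m → Fin n) w → rename ρ (weaken w) ≡ weaken w
rename-weaken ρ w = trans (rename-bsubst (λ ()) ρ w) (bsubst-cong (λ ()) w)

bsubst-weaken : ∀ {m n} (τ : Fin m → Term n) w → bsubst τ (weaken w) ≡ weaken w
bsubst-weaken τ w = trans (bsubst-bsubst (λ ()) τ w) (bsubst-cong (λ ()) w)

fsubst : ∀ {n} → (ℕ → Tm) → Term n → Term n
fsubst σ (bvar i)  = bvar i
fsubst σ (fvar x)  = weaken (σ x)
fsubst σ top       = top
fsubst σ (lam t u) = lam (fsubst σ t) (fsubst σ u)
fsubst σ (app u v) = app (fsubst σ u) (fsubst σ v)

fsubst-id : ∀ {n} (t : Term n) → fsubst fvar t ≡ t
fsubst-id (bvar i)  = refl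
fsubst-id (fvar x)  = refl
fsubst-id top       = refl
fsubst-id (lam t u) = cong₂ lam (fsubst-id t) (fsubst-id u)
fsubst-id (app u v) = cong₂ app (fsubst-id u) (fsubst-id v)

fsubst-rename : ∀ {m n} σ (ρ : Fin m → Fin n) t → fsubst σ (rename ρ t) ≡ rename ρ (fsubst σ t)
fsubst-rename σ ρ (bvar i)  = refl
fsubst-rename σ ρ (fvar x)  = sym (rename-weaken ρ (σ x))
fsubst-rename σ ρ top       = refl
fsubst-rename σ ρ (lam t u) = cong₂ lam (fsubst-rename σ ρ t) (fsubst-rename σ (ext ρ) u)
fsubst-rename σ ρ (app u v) = cong₂ app (fsubst-rename σ ρ u) (fsubst-rename σ ρ v)

fsubst-bsubst : ∀ {m n} σ (τ : Fin m → Term n) t →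
                fsubst σ (bsubst τ t) ≡ bsubst (fsubst σ ∘ τ) (fsubst σ t)
fsubst-bsubst σ τ (bvar i)  = refl
fsubst-bsubst σ τ (fvar x)  = sym (bsubst-weaken _ (σ x))
fsubst-bsubst σ τ top       = refl
fsubst-bsubst σ τ (lam t u) = cong₂ lam (fsubst-bsubst σ τ t)
  (trans (fsubst-bsubst σ (exts τ) u) (bsubst-cong fsubst-exts (fsubst σ u)))
  where
  fsubst-exts : ∀ i → fsubst σ (exts τ i) ≡ exts (fsubst σ ∘ τ) i
  fsubst-exts zero    = refl
  fsubst-exts (suc i) = fsubst-rename σ suc (τ i)
fsubst-bsubst σ τ (app u v) = cong₂ app (fsubst-bsubst σ τ u) (fsubst-bsubst σ τ v)

fsubst-inst : ∀ {n} σ (u : Term (suc n)) v → fsubst σ (inst u v) ≡ inst (fsubst σ u) (fsubst σ v)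
fsubst-inst σ u v = trans (fsubst-bsubst σ (inst1 v) u)
  (bsubst-cong (λ { zero → refl ; (suc i) → refl }) (fsubst σ u))

upd : (ℕ → Tm) → ℕ → Tm → ℕ → Tm
upd σ x w y with y ≟ x
... | yes _ = w
... | no _  = σ y

upd-≡ : ∀ σ x w → upd σ x w x ≡ w
upd-≡ σ x w with x ≟ x
... | yes _  = refl
... | no x≢x = ⊥-elim (x≢x refl)

upd-≢ : ∀ σ x w y → y ≢ x → upd σ x w y ≡ σ y
upd-≢ σ x w y y≢x with y ≟ x
... | yes y≡x = ⊥-elim (y≢x y≡x)
... | no _    = refl

fsubst-upd-fresh : ∀ {n} σ x w (t : Term n) → x ∉ fv t → fsubst (upd σ x w) t ≡ fsubst σ t
fsubst-upd-fresh σ x w (bvar i)  x∉ = refl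
fsubst-upd-fresh σ x w (fvar y)  x∉ = cong weaken (upd-≢ σ x w y (λ y≡x → x∉ (here (sym y≡x))))
fsubst-upd-fresh σ x w top       x∉ = refl
fsubst-upd-fresh σ x w (lam t u) x∉ = cong₂ lam
  (fsubst-upd-fresh σ x w t (x∉ ∘ ∈-++⁺ˡ)) (fsubst-upd-fresh σ x w u (x∉ ∘ ∈-++⁺ʳ (fv t)))
fsubst-upd-fresh σ x w (app t u) x∉ = cong₂ app
  (fsubst-upd-fresh σ x w t (x∉ ∘ ∈-++⁺ˡ)) (fsubst-upd-fresh σ x w u (x∉ ∘ ∈-++⁺ʳ (fv t)))

fsubst-upd-open₁ : ∀ σ x w (u : Term 1) → x ∉ fv u →
                   fsubst (upd σ x w) (open₁ u x) ≡ inst (fsubst σ u) w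
fsubst-upd-open₁ σ x w u x∉u = begin
  fsubst (upd σ x w) (open₁ u x)                          ≡⟨ fsubst-inst (upd σ x w) u (fvar x) ⟩
  inst (fsubst (upd σ x w) u) (weaken (upd σ x w x))      ≡⟨ cong₂ inst (fsubst-upd-fresh σ x w u x∉u)
                                                                       (cong weaken (upd-≡ σ x w)) ⟩
  inst (fsubst σ u) (weaken w)                            ≡⟨ cong (inst (fsubst σ u)) (weaken-id w) ⟩
  inst (fsubst σ u) w                                     ∎
  where open ≡-Reasoning

-- Equivalence reduction

→≡-refl : ∀ {n} (t : Term n) → t →≡ t
→≡-refl (bvar i)  = ≡-bvar
→≡-refl (fvar x)  = ≡-var
→≡-refl top       = ≡-top
→≡-refl (lam t u) = ≡-lam (→≡-refl t) (→≡-refl u)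
→≡-refl (app u v) = ≡-app (→≡-refl u) (→≡-refl v)

→≡-rename : ∀ {m n} (ρ : Fin m → Fin n) {t t'} → t →≡ t' → rename ρ t →≡ rename ρ t'
→≡-rename ρ ≡-bvar      = ≡-bvar
→≡-rename ρ ≡-var       = ≡-var
→≡-rename ρ ≡-top       = ≡-top
→≡-rename ρ ≡-topapp    = ≡-topapp
→≡-rename ρ (≡-app p q) = ≡-app (→≡-rename ρ p) (→≡-rename ρ q)
→≡-rename ρ (≡-beta {u' = u'} {v' = v'} p q) =
  subst (_ →≡_) (sym (inst-rename ρ u' v')) (≡-beta (→≡-rename (ext ρ) p) (→≡-rename ρ q))
→≡-rename ρ (≡-lam p q) = ≡-lam (→≡-rename ρ p) (→≡-rename (ext ρ) q)

→≡-exts : ∀ {m n} {σ τ : Fin m → Term n} → (∀ i → σ i →≡ τ i) → ∀ i → exts σ i →≡ exts τ i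
→≡-exts h zero    = ≡-bvar
→≡-exts h (suc i) = →≡-rename suc (h i)

→≡-bsubst : ∀ {m n} {σ τ : Fin m → Term n} → (∀ i → σ i →≡ τ i) →
            ∀ {t t'} → t →≡ t' → bsubst σ t →≡ bsubst τ t'
→≡-bsubst h (≡-bvar {i = i}) = h i
→≡-bsubst h ≡-var            = ≡-var
→≡-bsubst h ≡-top            = ≡-top
→≡-bsubst h ≡-topapp         = ≡-topapp
→≡-bsubst h (≡-app p q)      = ≡-app (→≡-bsubst h p) (→≡-bsubst h q)
→≡-bsubst {τ = τ} h (≡-beta {u' = u'} {v' = v'} p q) =
  subst (_ →≡_) (sym (inst-bsubst τ u' v')) (≡-beta (→≡-bsubst (→≡-exts h) p) (→≡-bsubst h q))
→≡-bsubst h (≡-lam p q)      = ≡-lam (→≡-bsubst h p) (→≡-bsubst (→≡-exts h) q)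

→≡-inst : ∀ {n} {u u' : Term (suc n)} {v v'} → u →≡ u' → v →≡ v' → inst u v →≡ inst u' v'
→≡-inst p q = →≡-bsubst (λ { zero → q ; (suc i) → ≡-bvar }) p

→≡-fsubst : ∀ {n} σ {u v : Term n} → u →≡ v → fsubst σ u →≡ fsubst σ v
→≡-fsubst σ ≡-bvar      = ≡-bvar
→≡-fsubst σ ≡-var       = →≡-refl _
→≡-fsubst σ ≡-top       = ≡-top
→≡-fsubst σ ≡-topapp    = ≡-topapp
→≡-fsubst σ (≡-app p q) = ≡-app (→≡-fsubst σ p) (→≡-fsubst σ q)
→≡-fsubst σ (≡-beta {u' = u'} {v' = v'} p q) =
  subst (_ →≡_) (sym (fsubst-inst σ u' v')) (≡-beta (→≡-fsubst σ p) (→≡-fsubst σ q))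
→≡-fsubst σ (≡-lam p q) = ≡-lam (→≡-fsubst σ p) (→≡-fsubst σ q)

→≡-diamond : ∀ {n} {t a b : Term n} → t →≡ a → t →≡ b → Σ (Term n) λ c → (a →≡ c) × (b →≡ c)
→≡-diamond ≡-bvar  ≡-bvar  = _ , ≡-bvar , ≡-bvar
→≡-diamond ≡-var   ≡-var   = _ , ≡-var , ≡-var
→≡-diamond ≡-top   ≡-top   = top , ≡-top , ≡-top
→≡-diamond ≡-topapp ≡-topapp = top , ≡-top , ≡-top
→≡-diamond ≡-topapp (≡-app ≡-top q) = top , ≡-top , ≡-topapp
→≡-diamond (≡-app ≡-top q) ≡-topapp = top , ≡-topapp , ≡-top
→≡-diamond (≡-app p q) (≡-app p' q') =
  let (c , pc , p'c) = →≡-diamond p p' ; (d , qd , q'd) = →≡-diamond q q' in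
  app c d , ≡-app pc qd , ≡-app p'c q'd
→≡-diamond (≡-app (≡-lam _ p) q) (≡-beta p' q') =
  let (c , pc , p'c) = →≡-diamond p p' ; (d , qd , q'd) = →≡-diamond q q' in
  inst c d , ≡-beta pc qd , →≡-inst p'c q'd
→≡-diamond (≡-beta p q) (≡-app (≡-lam _ p') q') =
  let (c , pc , p'c) = →≡-diamond p p' ; (d , qd , q'd) = →≡-diamond q q' in
  inst c d , →≡-inst pc qd , ≡-beta p'c q'd
→≡-diamond (≡-beta p q) (≡-beta p' q') =
  let (c , pc , p'c) = →≡-diamond p p' ; (d , qd , q'd) = →≡-diamond q q' in
  inst c d , →≡-inst pc qd , →≡-inst p'c q'd
→≡-diamond (≡-lam p q) (≡-lam p' q') =
  let (c , pc , p'c) = →≡-diamond p p' ; (d , qd , q'd) = →≡-diamond q q' in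
  lam c d , ≡-lam pc qd , ≡-lam p'c q'd

-- Reducing to ⊤

_↠⊤ : Tm → Set
t ↠⊤ = Star _→≡_ t top

spine : Tm → List Tm → Tm
spine t []      = t
spine t (a ∷ s) = spine (app t a) s

spine-→≡ : ∀ {t t'} s → t →≡ t' → spine t s →≡ spine t' s
spine-→≡ []      r = r
spine-→≡ (a ∷ s) r = spine-→≡ s (≡-app r (→≡-refl a))

→≡-pres-↠⊤ : ∀ {t t'} → t →≡ t' → t ↠⊤ → t' ↠⊤
→≡-pres-↠⊤ ≡-top ε = ε
→≡-pres-↠⊤ r (r₁ ◅ rs) = let (_ , r' , r₁') = →≡-diamond r r₁ in r' ◅ →≡-pres-↠⊤ r₁' rs

spine-top-↠⊤ : ∀ s → spine top s ↠⊤
spine-top-↠⊤ []      = ε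
spine-top-↠⊤ (a ∷ s) = spine-→≡ s ≡-topapp ◅ spine-top-↠⊤ s

lam-¬↠⊤ : ∀ {t u} → ¬ (lam t u ↠⊤)
lam-¬↠⊤ (≡-lam _ _ ◅ rs) = lam-¬↠⊤ rs

data Neutral : Tm → Set where
  fvar : ∀ {y} → Neutral (fvar y)
  app  : ∀ {a b} → Neutral a → Neutral (app a b)

→≡-pres-Neutral : ∀ {a b} → Neutral a → a →≡ b → Neutral b
→≡-pres-Neutral fvar    ≡-var         = fvar
→≡-pres-Neutral (app n) (≡-app p _)   = app (→≡-pres-Neutral n p)
→≡-pres-Neutral (app ()) ≡-topapp
→≡-pres-Neutral (app ()) (≡-beta _ _)

Neutral-¬↠⊤ : ∀ {a} → Neutral a → ¬ (a ↠⊤)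
Neutral-¬↠⊤ n (r ◅ rs) = Neutral-¬↠⊤ (→≡-pres-Neutral n r) rs

spine-Neutral : ∀ {a} s → Neutral a → Neutral (spine a s)
spine-Neutral []      n = n
spine-Neutral (b ∷ s) n = spine-Neutral s (app n)

-- Scoping

fv-rename : ∀ {m n} (ρ : Fin m → Fin n) t → fv (rename ρ t) ≡ fv t
fv-rename ρ (bvar i)  = refl
fv-rename ρ (fvar x)  = refl
fv-rename ρ top       = refl
fv-rename ρ (lam t u) = cong₂ _++_ (fv-rename ρ t) (fv-rename (ext ρ) u)
fv-rename ρ (app u v) = cong₂ _++_ (fv-rename ρ u) (fv-rename ρ v)

module _ {D : ℕ → Set} where

  fv-bsubst⁺ : ∀ {m n} (σ : Fin m → Term n) t →
               All D (fv t) → (∀ i → All D (fv (σ i))) → All D (fv (bsubst σ t))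
  fv-bsubst⁺ σ (bvar i)  d h = h i
  fv-bsubst⁺ σ (fvar x)  d h = d
  fv-bsubst⁺ σ top       d h = []
  fv-bsubst⁺ σ (lam t u) d h =
    ++⁺ (fv-bsubst⁺ σ t (++⁻ˡ (fv t) d) h) (fv-bsubst⁺ (exts σ) u (++⁻ʳ (fv t) d) h')
    where
    h' : ∀ i → All D (fv (exts σ i))
    h' zero    = []
    h' (suc i) = subst (All D) (sym (fv-rename suc (σ i))) (h i)
  fv-bsubst⁺ σ (app t u) d h = ++⁺ (fv-bsubst⁺ σ t (++⁻ˡ (fv t) d) h) (fv-bsubst⁺ σ u (++⁻ʳ (fv t) d) h)

  fv-bsubst⁻ : ∀ {m n} (σ : Fin m → Term n) t → All D (fv (bsubst σ t)) → All D (fv t)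
  fv-bsubst⁻ σ (bvar i)  d = []
  fv-bsubst⁻ σ (fvar x)  d = d
  fv-bsubst⁻ σ top       d = []
  fv-bsubst⁻ σ (lam t u) d = ++⁺ (fv-bsubst⁻ σ t (++⁻ˡ (fv (bsubst σ t)) d))
                                 (fv-bsubst⁻ (exts σ) u (++⁻ʳ (fv (bsubst σ t)) d))
  fv-bsubst⁻ σ (app t u) d = ++⁺ (fv-bsubst⁻ σ t (++⁻ˡ (fv (bsubst σ t)) d))
                                 (fv-bsubst⁻ σ u (++⁻ʳ (fv (bsubst σ t)) d))

  →≡-pres-fv : ∀ {n} {u v : Term n} → u →≡ v → All D (fv u) → All D (fv v)
  →≡-pres-fv ≡-bvar  d = d
  →≡-pres-fv ≡-var   d = d
  →≡-pres-fv ≡-top   d = d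
  →≡-pres-fv ≡-topapp d = []
  →≡-pres-fv (≡-app {u = u} p q) d = ++⁺ (→≡-pres-fv p (++⁻ˡ (fv u) d)) (→≡-pres-fv q (++⁻ʳ (fv u) d))
  →≡-pres-fv (≡-beta {t = t} {u = u} {u' = u'} {v' = v'} p q) d =
    fv-bsubst⁺ (inst1 v') u' (→≡-pres-fv p (++⁻ʳ (fv t) (++⁻ˡ (fv t ++ fv u) d)))
      (λ { zero → →≡-pres-fv q (++⁻ʳ (fv t ++ fv u) d) ; (suc i) → [] })
  →≡-pres-fv (≡-lam {t = t} p q) d = ++⁺ (→≡-pres-fv p (++⁻ˡ (fv t) d)) (→≡-pres-fv q (++⁻ʳ (fv t) d))

⊆dom-open₁⁺ : ∀ {Γ x α} (u : Term 1) → fv u ⊆dom Γ → fv (open₁ u x) ⊆dom (Γ , x ≤ α)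
⊆dom-open₁⁺ u u⊆Γ = fv-bsubst⁺ (inst1 (fvar _)) u (All.map there u⊆Γ) λ { zero → here ∷ [] ; (suc ()) }

⊆dom-open₁⁻ : ∀ {Γ x α} (u : Term 1) → x ∉ fv u → fv (open₁ u x) ⊆dom (Γ , x ≤ α) → fv u ⊆dom Γ
⊆dom-open₁⁻ u x∉u d = strengthen (fv u) x∉u (fv-bsubst⁻ (inst1 (fvar _)) u d)
  where
  strengthen : ∀ {Γ x α} xs → x ∉ xs → All (_∈dom (Γ , x ≤ α)) xs → xs ⊆dom Γ
  strengthen []       x∉ []            = []
  strengthen (y ∷ ys) x∉ (here ∷ _)    = ⊥-elim (x∉ (here refl))
  strengthen (y ∷ ys) x∉ (there d ∷ ds) = d ∷ strengthen ys (x∉ ∘ there) ds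

∉dom⇒∉ : ∀ {Γ x xs} → x ∉dom Γ → xs ⊆dom Γ → x ∉ xs
∉dom⇒∉ x∉Γ xs⊆Γ x∈xs = x∉Γ (All.lookup xs⊆Γ x∈xs)

Ann⇒∈dom : ∀ {Γ y t} → Ann y t Γ → y ∈dom Γ
Ann⇒∈dom here      = here
Ann⇒∈dom (there a) = there (Ann⇒∈dom a)

HasSub⇒∈dom : ∀ {Γ x t} → HasSub Γ x t → x ∈dom Γ
HasSub⇒∈dom here        = here
HasSub⇒∈dom (there _ h) = there (HasSub⇒∈dom h)

Ann-⊆dom : ∀ {Γ y t} → Prevalid Γ [] → Ann y t Γ → fv t ⊆dom Γ
Ann-⊆dom (pv-ann _ _ t⊆Γ) here      = All.map there t⊆Γ
Ann-⊆dom (pv-ann pΓ _ _)  (there a) = All.map there (Ann-⊆dom pΓ a)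

Prevalid-pop : ∀ {Γ s} → Prevalid Γ s → Prevalid Γ []
Prevalid-pop pv-empty       = pv-empty
Prevalid-pop (pv-ann p a b) = pv-ann p a b
Prevalid-pop (pv-push p _)  = Prevalid-pop p

→≤-Prevalid : ∀ {Γ s u v} → Γ ⨾ s ⊢ u →≤ v → Prevalid Γ []
→≤-Prevalid (r-prom p _) = Prevalid-pop p
→≤-Prevalid (r-top p)    = Prevalid-pop p
→≤-Prevalid (r-eq p _)   = Prevalid-pop p
→≤-Prevalid (r-app d)    = →≤-Prevalid d
→≤-Prevalid (r-funop _ _ _ d) with →≤-Prevalid d
... | pv-ann p _ _ = p
→≤-Prevalid (r-fun _ _ _ d) with →≤-Prevalid d
... | pv-ann p _ _ = p

wf-⊆dom : ∀ {Γ s t} → Γ ⨾ s ⊢ t wf → fv t ⊆dom Γ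
≤*wf-⊆dom : ∀ {Γ s v t} → Γ ⨾ s ⊢ v ≤*wf t → fv v ⊆dom Γ
wf-⊆dom (w-var _ h _) = HasSub⇒∈dom h ∷ []
wf-⊆dom (w-top _) = []
wf-⊆dom (w-fun   {u = u} x x∉u b t) = ++⁺ (wf-⊆dom t) (⊆dom-open₁⁻ u x∉u (wf-⊆dom b))
wf-⊆dom (w-funop {u = u} x x∉u b t) = ++⁺ (wf-⊆dom t) (⊆dom-open₁⁻ u x∉u (wf-⊆dom b))
wf-⊆dom (w-app l r) = ++⁺ (≤*wf-⊆dom l) (≤*wf-⊆dom r)
≤*wf-⊆dom (wf-sub (wf-rule v _ _)) = wf-⊆dom v
≤*wf-⊆dom (wf-trans l _ _)        = ≤*wf-⊆dom l

-- Preservation along subtyping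

Promotes : (ℕ → Tm) → Ctx → Set
Promotes σ Γ = ∀ {y t} → Ann y t Γ → ∀ args →
  spine (fsubst σ (fvar y)) args ↠⊤ → spine (fsubst σ t) args ↠⊤

fvar-Promotes : ∀ {Γ} → Promotes fvar Γ
fvar-Promotes _ args = ⊥-elim ∘ Neutral-¬↠⊤ (spine-Neutral args fvar)

upd-Promotes : ∀ {Γ x α σ} → Prevalid (Γ , x ≤ α) [] → Promotes σ Γ →
               Promotes (upd σ x (fsubst σ α)) (Γ , x ≤ α)
upd-Promotes {Γ} {x} {α} {σ} (pv-ann _ x∉Γ α⊆Γ) prom here args = subst (λ z → spine z args ↠⊤) (begin
  weaken (upd σ x w x)    ≡⟨ cong weaken (upd-≡ σ x w) ⟩
  weaken w                ≡⟨ weaken-id w ⟩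
  fsubst σ α              ≡⟨ fsubst-upd-fresh σ x w α (∉dom⇒∉ x∉Γ α⊆Γ) ⟨
  fsubst (upd σ x w) α    ∎)
  where
  open ≡-Reasoning
  w = fsubst σ α
upd-Promotes {Γ} {x} {α} {σ} (pv-ann pΓ x∉Γ _) prom (there {x = y} {t} a) args =
  subst (λ z → spine z args ↠⊤) (sym (fsubst-upd-fresh σ x w t (∉dom⇒∉ x∉Γ (Ann-⊆dom pΓ a))))
  ∘ prom a args
  ∘ subst (λ z → spine z args ↠⊤) (cong weaken (upd-≢ σ x w y y≢x))
  where
  w = fsubst σ α
  y≢x : y ≢ x
  y≢x y≡x = x∉Γ (subst (_∈dom Γ) y≡x (Ann⇒∈dom a))

map-fsubst-upd-fresh : ∀ {Γ x} σ w (as : List Tm) → x ∉dom Γ → All (λ a → fv a ⊆dom Γ) as →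
                       map (fsubst (upd σ x w)) as ≡ map (fsubst σ) as
map-fsubst-upd-fresh σ w []       x∉Γ []         = refl
map-fsubst-upd-fresh σ w (a ∷ as) x∉Γ (a⊆ ∷ as⊆) =
  cong₂ _∷_ (fsubst-upd-fresh σ _ w a (∉dom⇒∉ x∉Γ a⊆)) (map-fsubst-upd-fresh σ w as x∉Γ as⊆)

→≤-pres-↠⊤ : ∀ {Γ s u u'} → Γ ⨾ s ⊢ u →≤ u' →
             ∀ args {rest} → s ≡ args ++ rest → (σ : ℕ → Tm) → Promotes σ Γ →
             fv u ⊆dom Γ → All (λ a → fv a ⊆dom Γ) args →
             spine (fsubst σ u) (map (fsubst σ) args) ↠⊤ →
             fv u' ⊆dom Γ × spine (fsubst σ u') (map (fsubst σ) args) ↠⊤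
→≤-pres-↠⊤ (r-prom pv a) args eq σ prom u⊆ args⊆ p = Ann-⊆dom (Prevalid-pop pv) a , prom a (map (fsubst σ) args) p
→≤-pres-↠⊤ (r-top _)     args eq σ prom u⊆ args⊆ p = [] , spine-top-↠⊤ (map (fsubst σ) args)
→≤-pres-↠⊤ (r-eq _ r)    args eq σ prom u⊆ args⊆ p =
  →≡-pres-fv r u⊆ , →≡-pres-↠⊤ (spine-→≡ (map (fsubst σ) args) (→≡-fsubst σ r)) p
→≤-pres-↠⊤ (r-app {u = u} {v = v} d) args eq σ prom u⊆ args⊆ p =
  let (u'⊆ , p') = →≤-pres-↠⊤ d (v ∷ args) (cong (v ∷_) eq) σ prom
                     (++⁻ˡ (fv u) u⊆) (++⁻ʳ (fv u) u⊆ ∷ args⊆) p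
  in ++⁺ u'⊆ (++⁻ʳ (fv u) u⊆) , p'
→≤-pres-↠⊤ (r-funop _ _ _ _) [] eq σ prom u⊆ args⊆ p = ⊥-elim (lam-¬↠⊤ p)
→≤-pres-↠⊤ (r-funop {α = α} {t} {u} {u'} x x∉u x∉u' d) (.α ∷ args) refl σ prom u⊆ (_ ∷ args⊆) p
  with →≤-Prevalid d
... | pΓx@(pv-ann _ x∉Γ _) =
  let (u'⊆ , p') = →≤-pres-↠⊤ d args refl σ' (upd-Promotes pΓx prom)
                     (⊆dom-open₁⁺ u (++⁻ʳ (fv t) u⊆)) (All.map (All.map there) args⊆)
                     (subst _↠⊤ (sym (reduct u x∉u)) (→≡-pres-↠⊤ β p))
  in ++⁺ (++⁻ˡ (fv t) u⊆) (⊆dom-open₁⁻ u' x∉u' u'⊆) , β ◅ subst _↠⊤ (reduct u' x∉u') p'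
  where
  w = fsubst σ α
  σ' = upd σ x w
  β : ∀ {v} → spine (app (lam (fsubst σ t) v) w) (map (fsubst σ) args) →≡
              spine (inst v w) (map (fsubst σ) args)
  β = spine-→≡ (map (fsubst σ) args) (≡-beta (→≡-refl _) (→≡-refl _))
  reduct : ∀ v → x ∉ fv v → spine (fsubst σ' (open₁ v x)) (map (fsubst σ') args) ≡
                             spine (inst (fsubst σ v) w) (map (fsubst σ) args)
  reduct v x∉v = cong₂ spine (fsubst-upd-open₁ σ x w v x∉v) (map-fsubst-upd-fresh σ w args x∉Γ args⊆)
→≤-pres-↠⊤ (r-fun _ _ _ _) [] eq σ prom u⊆ args⊆ p = ⊥-elim (lam-¬↠⊤ p)

≤-pres-↠⊤ : ∀ {Γ s v t} → Γ ⨾ s ⊢ v ≤ t → fv v ⊆dom Γ → v ↠⊤ → t ↠⊤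
≤-pres-↠⊤ (s-refl _) v⊆ p = p
≤-pres-↠⊤ (s-step {v' = v'} r d) v⊆ p =
  let (v'⊆ , p') = →≤-pres-↠⊤ r [] refl fvar fvar-Promotes v⊆ [] (subst _↠⊤ (sym (fsubst-id _)) p)
  in ≤-pres-↠⊤ d v'⊆ (subst _↠⊤ (fsubst-id v') p')
≤-pres-↠⊤ (s-eq d r) v⊆ p = r ◅ ≤-pres-↠⊤ d v⊆ p

≤*wf-pres-↠⊤ : ∀ {Γ s v t} → Γ ⨾ s ⊢ v ≤*wf t → v ↠⊤ → t ↠⊤
≤*wf-pres-↠⊤ (wf-sub (wf-rule v _ v≤t)) = ≤-pres-↠⊤ v≤t (wf-⊆dom v)
≤*wf-pres-↠⊤ (wf-trans v≤u u≤t _)       = ≤*wf-pres-↠⊤ u≤t ∘ ≤*wf-pres-↠⊤ v≤u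

theorem4p3 : (Γ : Ctx) (s : Stack) (t : Tm) (u : Term 1) →
    ¬ (Γ ⨾ s ⊢ top ≤*wf lam t u)
theorem4p3 Γ s t u top≤lam = lam-¬↠⊤ (≤*wf-pres-↠⊤ top≤lam ε)
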